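{- For every integer $i\ge2$, $\overline{\alpha}(\{1,3,2i\})=\frac{i}{2i+3}$.
   Context: For a finite set $S$ of positive integers, the distance graph $G(S)$ has vertex set $\mathbb{Z}$, with $i,j$ adjacent iff $|i-j|\in S$. For $A\subseteq\mathbb{Z}$, $\delta(A)=\limsup_{N\to\infty}\frac{|A\cap[-N,N]|}{2N+1}$. The independence ratio $\overline{\alpha}(S)$ is the supremum of $\delta(A)$ over all independent sets $A$ of $G(S)$. -}

module Defs where

open import Data.Bool using (Bool; true; false; if_then_else_)
open import Data.Nat as ℕ using (ℕ; zero; suc)
open import Data.Integer as ℤ using (ℤ; +_; -[1+_]; ∣_∣)
open import Data.Rational as ℚ using (ℚ; _/_; 0ℚ)
open import Data.List using (List; []; _∷_)
open import Data.List.Membership.Propositional using (_∈_)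
open import Data.Product using (Σ; _×_; ∃-syntax)
open import Relation.Binary.PropositionalEquality using (_≡_)
open import Relation.Nullary using (¬_)

Subsetℤ : Set
Subsetℤ = ℤ → Bool

Independent : List ℕ → Subsetℤ → Set
Independent S A = ∀ x y → A x ≡ true → A y ≡ true → ¬ (∣ x ℤ.- y ∣ ∈ S)

countSym : Subsetℤ → ℕ → ℕ
countSym A zero = if A (+ 0) then 1 else 0
countSym A (suc n) =
  (if A (+ suc n) then 1 else 0) ℕ.+ (if A -[1+ n ] then 1 else 0) ℕ.+ countSym A n

ratio : Subsetℤ → ℕ → ℚ
ratio A N = (+ countSym A N) / suc (2 ℕ.* N)

-- δ(A) ≤ r  (limsup of ratio ≤ r): for every ε > 0, eventually ratio ≤ r + ε.
DensityAtMost : Subsetℤ → ℚ → Set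
DensityAtMost A r =
  ∀ (ε : ℚ) → 0ℚ ℚ.< ε → ∃[ N₀ ] (∀ N → N₀ ℕ.≤ N → ratio A N ℚ.≤ r ℚ.+ ε)

-- δ(A) ≥ r  (limsup of ratio ≥ r): for every ε > 0, infinitely often ratio > r - ε.
DensityAtLeast : Subsetℤ → ℚ → Set
DensityAtLeast A r =
  ∀ (ε : ℚ) → 0ℚ ℚ.< ε → ∀ N₀ → ∃[ N ] (N₀ ℕ.≤ N × r ℚ.- ε ℚ.< ratio A N)

-- ᾱ(S) = r : every independent set has density ≤ r (sup ≤ r), and for every
-- ε > 0 some independent set has density ≥ r - ε (sup ≥ r).
IndependenceRatioIs : List ℕ → ℚ → Set
IndependenceRatioIs S r =
  (∀ A → Independent S A → DensityAtMost A r) ×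
  (∀ (ε : ℚ) → 0ℚ ℚ.< ε → ∃[ A ] (Independent S A × DensityAtLeast A (r ℚ.- ε)))

module Submission where

-- Let f : ℕ → Bool mark the elements of an independent set. As distance 1 is forbidden, a block
-- of length 2n + 1 contains at most n + 1 marks, and only if both of its ends are marked; as
-- distance 3 is forbidden too, a block of length 2n + 2 with n + 1 marks that starts with a mark
-- also has one at 2n. For i ≥ 2 the forbidden distance 2i rules out these extremal patterns in a
-- block of length 2i + 3, so each such block has at most i marks, and cutting [-N, N] into blocks
-- bounds the density by i / (2i + 3). Conversely, the integers whose residue modulo 2i + 3 lies in
-- {0, 2, …, 2i − 2} form an independent set with exactly i elements per period.

open import Defs
open import Data.Nat using (ℕ; suc; _≤_; _+_; _*_)
open import Data.Integer using (+_)
open import Data.Rational using (_/_)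
open import Data.List using (_∷_; [])

open import Data.Bool using (Bool; true; false; if_then_else_)
open import Data.Bool.Properties using (¬-not; not-¬)
open import Data.Empty using (⊥; ⊥-elim)
open import Data.List.Membership.Propositional using (_∈_)
open import Data.List.Relation.Unary.Any using (here; there)
open import Data.Nat using (zero; _<_; z≤n; s≤s; s≤s⁻¹; NonZero)
open import Data.Nat.Properties
open import Data.Nat.DivMod using (_%_; m≡m%n+[m/n]*n; m%n<n; m<n⇒m%n≡m; [m+n]%n≡m%n; m*n%n≡0)
  renaming (_/_ to _div_)
open import Data.Nat.Coprimality using (Coprime)
open import Data.Nat.Tactic.RingSolver using (solve-∀)
import Data.Integer as ℤ
open ℤ using (ℤ; -[1+_]; ∣_∣)
open import Data.Integer.DivMod using (_%ℕ_; _/ℕ_; n%ℕd<d; a≡a%ℕn+[a/ℕn]*n)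
import Data.Integer.Properties as ℤP
import Data.Integer.Tactic.RingSolver as ℤSolver
import Data.Rational as ℚ
open ℚ using (mkℚ; 0ℚ)
import Data.Rational.Properties as ℚP
import Data.Rational.Unnormalised as ℚᵘ
import Data.Rational.Unnormalised.Properties as ℚᵘP
open import Data.Product using (_×_; _,_; proj₁; proj₂; ∃-syntax)
open import Function using (_∘_)
open import Relation.Binary.PropositionalEquality

double : ℕ → ℕ
double zero    = zero
double (suc n) = suc (suc (double n))

double≡+ : ∀ n → double n ≡ n + n
double≡+ zero    = refl
double≡+ (suc n) = cong suc (trans (cong suc (double≡+ n)) (sym (+-suc n n)))

double≡2* : ∀ n → double n ≡ 2 * n
double≡2* n = trans (double≡+ n) (cong (_+_ n) (sym (+-identityʳ n)))

double-* : ∀ m n → double (m * n) ≡ double m * n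
double-* m n =
  trans (double≡+ (m * n)) (trans (sym (*-distribʳ-+ n m m)) (cong (_* n) (sym (double≡+ m))))

double-mono-≤ : ∀ {m n} → m ≤ n → double m ≤ double n
double-mono-≤ z≤n     = z≤n
double-mono-≤ (s≤s h) = s≤s (s≤s (double-mono-≤ h))

period : ℕ → ℕ
period i = suc (double (suc i))

period≡ : ∀ i → period i ≡ suc (2 * i + 2)
period≡ i = cong suc (trans (+-comm 2 (double i)) (cong (_+ 2) (double≡2* i)))

𝟙 : Bool → ℕ
𝟙 b = if b then 1 else 0

𝟙≤1 : ∀ b → 𝟙 b ≤ 1
𝟙≤1 true  = s≤s z≤n
𝟙≤1 false = z≤n

count : (ℕ → Bool) → ℕ → ℕ
count f zero    = 0
count f (suc n) = 𝟙 (f 0) + count (f ∘ suc) n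

count-≤ : ∀ f n → count f n ≤ n
count-≤ f zero    = z≤n
count-≤ f (suc n) = +-mono-≤ (𝟙≤1 (f 0)) (count-≤ (f ∘ suc) n)

count-suc-≤ : ∀ f n → count f (suc n) ≤ suc (count (f ∘ suc) n)
count-suc-≤ f n = +-monoˡ-≤ (count (f ∘ suc) n) (𝟙≤1 (f 0))

count-head-true : ∀ f n → f 0 ≡ true → count f (suc n) ≡ suc (count (f ∘ suc) n)
count-head-true f n eq rewrite eq = refl

count-head-false : ∀ f n → f 0 ≡ false → count f (suc n) ≡ count (f ∘ suc) n
count-head-false f n eq rewrite eq = refl

count-+ : ∀ f m n → count f (m + n) ≡ count f m + count (λ k → f (m + k)) n
count-+ f zero    n = refl
count-+ f (suc m) n =
  trans (cong (_+_ (𝟙 (f 0))) (count-+ (f ∘ suc) m n)) (sym (+-assoc (𝟙 (f 0)) _ _))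

count-snoc : ∀ f n → count f (suc n) ≡ count f n + 𝟙 (f n)
count-snoc f zero    = +-identityʳ (𝟙 (f 0))
count-snoc f (suc n) =
  trans (cong (_+_ (𝟙 (f 0))) (count-snoc (f ∘ suc) n)) (sym (+-assoc (𝟙 (f 0)) _ _))

count-last-true : ∀ f n → f n ≡ true → count f (suc n) ≡ suc (count f n)
count-last-true f n eq =
  trans (count-snoc f n) (trans (cong (λ b → count f n + 𝟙 b) eq) (+-comm (count f n) 1))

count-last-false : ∀ f n → f n ≡ false → count f (suc n) ≡ count f n
count-last-false f n eq =
  trans (count-snoc f n) (trans (cong (λ b → count f n + 𝟙 b) eq) (+-identityʳ (count f n)))

count-cong : ∀ {f g} n → (∀ k → k < n → f k ≡ g k) → count f n ≡ count g n
count-cong zero    eq = refl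
count-cong (suc n) eq =
  cong₂ (λ b c → 𝟙 b + c) (eq 0 (s≤s z≤n)) (count-cong n (λ k k<n → eq (suc k) (s≤s k<n)))

count-shift-assoc : ∀ f m n p → count (λ k → f (m + (n + k))) p ≡ count (λ k → f (m + n + k)) p
count-shift-assoc f m n p = count-cong p (λ k _ → cong f (sym (+-assoc m n k)))

count>⇒head : ∀ f n → count (f ∘ suc) n < count f (suc n) → f 0 ≡ true
count>⇒head f n h with f 0
... | true  = refl
... | false = ⊥-elim (<-irrefl refl h)

count>⇒last : ∀ f n → count f n < count f (suc n) → f n ≡ true
count>⇒last f n h with f n in eq
... | true  = refl
... | false = ⊥-elim (<-irrefl (sym (count-last-false f n eq)) h)

count-blocks-≤ : ∀ f p c → (∀ m → count (λ k → f (m + k)) p ≤ c) →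
                 ∀ q m → count (λ k → f (m + k)) (q * p) ≤ q * c
count-blocks-≤ f p c bound zero    m = z≤n
count-blocks-≤ f p c bound (suc q) m = begin
  count (λ k → f (m + k)) (p + q * p)
    ≡⟨ count-+ (λ k → f (m + k)) p (q * p) ⟩
  count (λ k → f (m + k)) p + count (λ k → f (m + (p + k))) (q * p)
    ≡⟨ cong (_+_ (count (λ k → f (m + k)) p)) (count-shift-assoc f m p (q * p)) ⟩
  count (λ k → f (m + k)) p + count (λ k → f (m + p + k)) (q * p)
    ≤⟨ +-mono-≤ (bound m) (count-blocks-≤ f p c bound q (m + p)) ⟩
  c + q * c
    ∎
  where open ≤-Reasoning

count-linear-≤ : ∀ f p c L .{{_ : NonZero p}} → (∀ m → count (λ k → f (m + k)) p ≤ c) →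
                 count f L * p ≤ c * L + p * p
count-linear-≤ f p c L bound = begin
  count f L * p
    ≡⟨ cong (λ n → count f n * p) L≡r+qp ⟩
  count f (r + q * p) * p
    ≡⟨ cong (_* p) (count-+ f r (q * p)) ⟩
  (count f r + count (λ k → f (r + k)) (q * p)) * p
    ≤⟨ *-monoˡ-≤ p (+-mono-≤ (count-≤ f r) (count-blocks-≤ f p c bound q r)) ⟩
  (r + q * c) * p
    ≡⟨ distribute r q c p ⟩
  r * p + c * (q * p)
    ≤⟨ +-mono-≤ (*-monoˡ-≤ p (<⇒≤ (m%n<n L p)))
                (*-monoʳ-≤ c (subst (q * p ≤_) (sym L≡r+qp) (m≤n+m (q * p) r))) ⟩
  p * p + c * L
    ≡⟨ +-comm (p * p) (c * L) ⟩
  c * L + p * p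
    ∎
  where
    open ≤-Reasoning
    r q : ℕ
    r = L % p
    q = L div p
    L≡r+qp : L ≡ r + q * p
    L≡r+qp = m≡m%n+[m/n]*n L p
    distribute : ∀ r q c p → (r + q * c) * p ≡ r * p + c * (q * p)
    distribute = solve-∀

count-periodic : ∀ f p q → (∀ k → f (p + k) ≡ f k) → count f (q * p) ≡ q * count f p
count-periodic f p zero    periodic = refl
count-periodic f p (suc q) periodic = begin
  count f (p + q * p)
    ≡⟨ count-+ f p (q * p) ⟩
  count f p + count (λ k → f (p + k)) (q * p)
    ≡⟨ cong (_+_ (count f p)) (count-cong (q * p) (λ k _ → periodic k)) ⟩
  count f p + count f (q * p)
    ≡⟨ cong (_+_ (count f p)) (count-periodic f p q periodic) ⟩
  count f p + q * count f p
    ∎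
  where open ≡-Reasoning

Avoids : ℕ → (ℕ → Bool) → Set
Avoids d f = ∀ k → f k ≡ true → f (k + d) ≡ true → ⊥

avoids-shift : ∀ {d} f m → Avoids d f → Avoids d (λ k → f (m + k))
avoids-shift {d} f m av k fk fkd =
  av (m + k) fk (subst (λ x → f x ≡ true) (sym (+-assoc m k d)) fkd)

avoids-false : ∀ {d} f k → Avoids d f → f k ≡ true → f (k + d) ≡ false
avoids-false f k av fk = ¬-not (av k fk)

avoids-1-false : ∀ f k → Avoids 1 f → f (suc k) ≡ true → f k ≡ false
avoids-1-false f k av fsk = ¬-not (λ fk → av k fk (subst (λ x → f x ≡ true) (+-comm 1 k) fsk))

count-pair-≤ : ∀ f n → Avoids 1 f → count f (suc (suc n)) ≤ suc (count (f ∘ suc ∘ suc) n)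
count-pair-≤ f n av with f 0 in f0
... | true  = ≤-reflexive (cong suc (count-head-false (f ∘ suc) n (avoids-false f 0 av f0)))
... | false = count-suc-≤ (f ∘ suc) n

count-double-≤ : ∀ f n → Avoids 1 f → count f (double n) ≤ n
count-double-≤ f zero    av = z≤n
count-double-≤ f (suc n) av =
  ≤-trans (count-pair-≤ f (double n) av) (s≤s (count-double-≤ (f ∘ suc ∘ suc) n (λ k → av (2 + k))))

count-odd-≤ : ∀ f n → Avoids 1 f → count f (suc (double n)) ≤ suc n
count-odd-≤ f n av =
  ≤-trans (count-suc-≤ f (double n)) (s≤s (count-double-≤ (f ∘ suc) n (λ k → av (1 + k))))

count-odd-tight : ∀ f n → Avoids 1 f → suc n ≤ count f (suc (double n)) →
                  f 0 ≡ true × f (double n) ≡ true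
count-odd-tight f zero    av h = count>⇒head f 0 h , count>⇒head f 0 h
count-odd-tight f (suc n) av h = f0 , proj₂ inner
  where
    av₂ : Avoids 1 (f ∘ suc ∘ suc)
    av₂ k = av (2 + k)
    inner : f 2 ≡ true × f (double (suc n)) ≡ true
    inner = count-odd-tight (f ∘ suc ∘ suc) n av₂
              (s≤s⁻¹ (≤-trans h (count-pair-≤ f (suc (double n)) av)))
    tail-≤ : count (f ∘ suc) (suc (suc (double n))) ≤ suc n
    tail-≤ = ≤-trans
      (≤-reflexive (count-head-false (f ∘ suc) (suc (double n)) (avoids-1-false f 1 av (proj₁ inner))))
      (count-odd-≤ (f ∘ suc ∘ suc) n av₂)
    f0 : f 0 ≡ true
    f0 = count>⇒head f (suc (suc (double n))) (<-≤-trans (s≤s tail-≤) h)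

count-even-tight : ∀ f n → Avoids 1 f → Avoids 3 f →
                   suc n ≤ count f (double (suc n)) → f 0 ≡ true → f (double n) ≡ true
count-even-tight f zero    av₁ av₃ h f0 = f0
count-even-tight f (suc n) av₁ av₃ h f0 =
  count-even-tight (f ∘ suc ∘ suc) n (λ k → av₁ (2 + k)) (λ k → av₃ (2 + k)) h₂ f2
  where
    drop-two : count f (double (suc (suc n))) ≡ suc (count (f ∘ suc ∘ suc) (double (suc n)))
    drop-two = trans (count-head-true f (suc (suc (suc (double n)))) f0)
                     (cong suc (count-head-false (f ∘ suc) (double (suc n)) (avoids-false f 0 av₁ f0)))
    h₂ : suc n ≤ count (f ∘ suc ∘ suc) (double (suc n))
    h₂ = s≤s⁻¹ (≤-trans h (≤-reflexive drop-two))
    after-3 : count (f ∘ suc ∘ suc ∘ suc) (suc (double n)) ≤ n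
    after-3 = ≤-trans
      (≤-reflexive (count-head-false (f ∘ suc ∘ suc ∘ suc) (double n) (avoids-false f 0 av₃ f0)))
      (count-double-≤ (λ k → f (4 + k)) n (λ k → av₁ (4 + k)))
    f2 : f 2 ≡ true
    f2 = count>⇒head (f ∘ suc ∘ suc) (suc (double n)) (<-≤-trans (s≤s after-3) h₂)

count-window-even-≤ : ∀ f i → Avoids 1 f → Avoids 3 f → Avoids (double i) f →
                      count f (double (suc i)) ≤ i
count-window-even-≤ f i av₁ av₃ av₂ᵢ = ≮⇒≥ full⇒⊥
  where
    full⇒⊥ : i < count f (double (suc i)) → ⊥
    full⇒⊥ h = by-head (f 0) refl
      where
        by-head : ∀ b → f 0 ≡ b → ⊥
        by-head true  f0 = av₂ᵢ 0 f0 (count-even-tight f i av₁ av₃ h f0)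
        by-head false f0 = av₂ᵢ 1 (proj₁ ends) (proj₂ ends)
          where
            ends : f 1 ≡ true × f (suc (double i)) ≡ true
            ends = count-odd-tight (f ∘ suc) i (λ k → av₁ (suc k))
                     (≤-trans h (≤-reflexive (count-head-false f (suc (double i)) f0)))

-- A block [0, 2i + 2] with i + 1 marks has both ends marked (each of [0, 2i + 1] and [1, 2i + 2]
-- holds at most i), which leaves 1, 2, 3 and 2i + 1 unmarked; the block [4, 2i] then holds i − 1
-- marks, so 2i is marked, at distance 2i from 0.
count-window-≤ : ∀ f j → Avoids 1 f → Avoids 3 f → Avoids (double (suc (suc j))) f →
                 count f (period (suc (suc j))) ≤ suc (suc j)
count-window-≤ f j av₁ av₃ av₂ᵢ = ≮⇒≥ full⇒⊥
  where
    i : ℕ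
    i = suc (suc j)
    full⇒⊥ : i < count f (period i) → ⊥
    full⇒⊥ h = av₂ᵢ 0 f0 (proj₂ (count-odd-tight (λ k → f (4 + k)) j (λ k → av₁ (4 + k)) middle))
      where
        f0 : f 0 ≡ true
        f0 = count>⇒head f (double (suc i)) (<-≤-trans (s≤s (count-window-even-≤ (f ∘ suc) i
               (λ k → av₁ (suc k)) (λ k → av₃ (suc k)) (λ k → av₂ᵢ (suc k)))) h)
        flast : f (suc (suc (double i))) ≡ true
        flast = count>⇒last f (double (suc i))
                  (<-≤-trans (s≤s (count-window-even-≤ f i av₁ av₃ av₂ᵢ)) h)
        f1 : f 1 ≡ false
        f1 = avoids-false f 0 av₁ f0
        f2 : f 2 ≡ false
        f2 = ¬-not (λ f2 → av₂ᵢ 2 f2 flast)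
        f3 : f 3 ≡ false
        f3 = avoids-false f 0 av₃ f0
        f2i+1 : f (suc (double i)) ≡ false
        f2i+1 = avoids-1-false f (suc (double i)) av₁ flast
        decomposition : count f (period i) ≡ suc (suc (count (λ k → f (4 + k)) (suc (double j))))
        decomposition = begin
          count f (period i)
            ≡⟨ count-last-true f (suc (suc (double i))) flast ⟩
          suc (count f (suc (suc (double i))))
            ≡⟨ cong suc (count-last-false f (suc (double i)) f2i+1) ⟩
          suc (count f (suc (double i)))
            ≡⟨ cong suc (count-head-true f (double i) f0) ⟩
          suc (suc (count (f ∘ suc) (double i)))
            ≡⟨ cong (suc ∘ suc) (count-head-false (f ∘ suc) (suc (suc (suc (double j)))) f1) ⟩
          suc (suc (count (f ∘ suc ∘ suc) (suc (suc (suc (double j))))))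
            ≡⟨ cong (suc ∘ suc) (count-head-false (f ∘ suc ∘ suc) (suc (suc (double j))) f2) ⟩
          suc (suc (count (f ∘ suc ∘ suc ∘ suc) (suc (suc (double j)))))
            ≡⟨ cong (suc ∘ suc) (count-head-false (f ∘ suc ∘ suc ∘ suc) (suc (double j)) f3) ⟩
          suc (suc (count (λ k → f (4 + k)) (suc (double j))))
            ∎
          where open ≡-Reasoning
        middle : suc j ≤ count (λ k → f (4 + k)) (suc (double j))
        middle = s≤s⁻¹ (s≤s⁻¹ (≤-trans h (≤-reflexive decomposition)))

seqFrom : Subsetℤ → ℤ → ℕ → Bool
seqFrom A a k = A (a ℤ.+ + k)

independent⇒avoids : ∀ {S A d} a → Independent S A → d ∈ S → Avoids d (seqFrom A a)
independent⇒avoids {S} {A} {d} a indep d∈S k Ak Akd =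
  indep (a ℤ.+ + (k + d)) (a ℤ.+ + k) Akd Ak (subst (_∈ S) (sym distance) d∈S)
  where
    cancel : ∀ a x y → (a ℤ.+ (x ℤ.+ y)) ℤ.- (a ℤ.+ x) ≡ y
    cancel = ℤSolver.solve-∀
    distance : ∣ (a ℤ.+ + (k + d)) ℤ.- (a ℤ.+ + k) ∣ ≡ d
    distance = cong ∣_∣ (trans (cong (λ z → (a ℤ.+ z) ℤ.- (a ℤ.+ + k)) (ℤP.pos-+ k d))
                               (cancel a (+ k) (+ d)))

countSym≡count : ∀ A N → countSym A N ≡ count (seqFrom A (ℤ.- + N)) (suc (double N))
countSym≡count A zero    = sym (+-identityʳ _)
countSym≡count A (suc n) = begin
  𝟙 (A (+ suc n)) + 𝟙 (A -[1+ n ]) + countSym A n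
    ≡⟨ rotate (𝟙 (A (+ suc n))) (𝟙 (A -[1+ n ])) _ ⟩
  𝟙 (A -[1+ n ]) + (countSym A n + 𝟙 (A (+ suc n)))
    ≡⟨ cong (λ c → 𝟙 (A -[1+ n ]) + (c + 𝟙 (A (+ suc n)))) (countSym≡count A n) ⟩
  𝟙 (A -[1+ n ]) + (count f (suc (double n)) + 𝟙 (A (+ suc n)))
    ≡⟨ cong (λ z → 𝟙 (A -[1+ n ]) + (count f (suc (double n)) + 𝟙 (A z))) (sym right-end) ⟩
  𝟙 (A -[1+ n ]) + (count f (suc (double n)) + 𝟙 (f (suc (double n))))
    ≡⟨ cong (_+_ (𝟙 (A -[1+ n ]))) (sym (count-snoc f (suc (double n)))) ⟩
  𝟙 (A -[1+ n ]) + count f (suc (suc (double n)))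
    ≡⟨ cong (_+_ (𝟙 (A -[1+ n ]))) (count-cong (suc (suc (double n))) (λ k _ → cong A (sym (shift k)))) ⟩
  count (seqFrom A -[1+ n ]) (suc (suc (suc (double n))))
    ∎
  where
    open ≡-Reasoning
    f : ℕ → Bool
    f = seqFrom A (ℤ.- + n)
    rotate : ∀ a b c → a + b + c ≡ b + (c + a)
    rotate = solve-∀
    shift : ∀ k → -[1+ n ] ℤ.+ + suc k ≡ ℤ.- + n ℤ.+ + k
    shift k = trans (ℤP.-m+n≡n⊖m (suc n) (suc k))
                    (trans (ℤP.[1+m]⊖[1+n]≡m⊖n k n) (sym (ℤP.-m+n≡n⊖m n k)))
    right-end : ℤ.- + n ℤ.+ + suc (double n) ≡ + suc n
    right-end = trans (ℤP.-m+n≡n⊖m n _)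
      (trans (cong₂ ℤ._⊖_ (trans (cong suc (double≡+ n)) (sym (+-suc n n))) (sym (+-identityʳ n)))
             (ℤP.+-cancelˡ-⊖ n (suc n) 0))

countSym-independent-≤ : ∀ j A → Independent (1 ∷ 3 ∷ 2 * suc (suc j) ∷ []) A → ∀ N →
  countSym A N * suc (2 * suc (suc j) + 2) ≤
  suc (suc j) * suc (2 * N) + suc (2 * suc (suc j) + 2) * suc (2 * suc (suc j) + 2)
countSym-independent-≤ j A indep N = begin
  countSym A N * suc (2 * i + 2)
    ≡⟨ cong₂ _*_ (countSym≡count A N) (sym (period≡ i)) ⟩
  count f (suc (double N)) * period i
    ≤⟨ count-linear-≤ f (period i) i (suc (double N)) window ⟩
  i * suc (double N) + period i * period i
    ≡⟨ cong₂ (λ L p → i * suc L + p * p) (double≡2* N) (period≡ i) ⟩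
  i * suc (2 * N) + suc (2 * i + 2) * suc (2 * i + 2)
    ∎
  where
    open ≤-Reasoning
    i : ℕ
    i = suc (suc j)
    f : ℕ → Bool
    f = seqFrom A (ℤ.- + N)
    avoids : ∀ {d} → d ∈ 1 ∷ 3 ∷ 2 * i ∷ [] → ∀ m → Avoids d (λ k → f (m + k))
    avoids d∈S m = avoids-shift f m (independent⇒avoids (ℤ.- + N) indep d∈S)
    window : ∀ m → count (λ k → f (m + k)) (period i) ≤ i
    window m = count-window-≤ _ j (avoids (here refl) m) (avoids (there (here refl)) m)
      (avoids (subst (_∈ 1 ∷ 3 ∷ 2 * i ∷ []) (sym (double≡2* i)) (there (there (here refl)))) m)

%ℕ-unique : ∀ z p q r .{{_ : NonZero p}} → r < p → z ≡ + r ℤ.+ q ℤ.* + p → z %ℕ p ≡ r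
%ℕ-unique z p q r r<p z≡ = ℤP.+-injective (ℤP.i-j≡0⇒i≡j _ _ (ℤP.∣i∣≡0⇒i≡0 ∣D∣≡0))
  where
    r′ : ℕ
    r′ = z %ℕ p
    q′ : ℤ
    q′ = z /ℕ p
    regroup : ∀ R R′ Q Q′ P →
              R′ ℤ.- R ≡ ((R′ ℤ.+ Q′ ℤ.* P) ℤ.- (R ℤ.+ Q ℤ.* P)) ℤ.+ (Q ℤ.- Q′) ℤ.* P
    regroup = ℤSolver.solve-∀
    D≡ : + r′ ℤ.- + r ≡ (q ℤ.- q′) ℤ.* + p
    D≡ = begin
      + r′ ℤ.- + r
        ≡⟨ regroup (+ r) (+ r′) q q′ (+ p) ⟩
      ((+ r′ ℤ.+ q′ ℤ.* + p) ℤ.- (+ r ℤ.+ q ℤ.* + p)) ℤ.+ (q ℤ.- q′) ℤ.* + p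
        ≡⟨ cong (ℤ._+ (q ℤ.- q′) ℤ.* + p)
                (trans (cong₂ ℤ._-_ (sym (a≡a%ℕn+[a/ℕn]*n z p)) (sym z≡)) (ℤP.+-inverseʳ z)) ⟩
      ℤ.0ℤ ℤ.+ (q ℤ.- q′) ℤ.* + p
        ≡⟨ ℤP.+-identityˡ _ ⟩
      (q ℤ.- q′) ℤ.* + p
        ∎
      where open ≡-Reasoning
    ∣D∣<p : ∣ + r′ ℤ.- + r ∣ < p
    ∣D∣<p = subst (_< p) (cong ∣_∣ (sym (ℤP.m-n≡m⊖n r′ r)))
              (≤-<-trans (ℤP.∣m⊝n∣≤m⊔n r′ r) (⊔-pres-<m (n%ℕd<d z p) r<p))
    ∣D∣≡ : ∣ + r′ ℤ.- + r ∣ ≡ ∣ q ℤ.- q′ ∣ * p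
    ∣D∣≡ = trans (cong ∣_∣ D≡) (ℤP.abs-* (q ℤ.- q′) (+ p))
    ∣D∣≡0 : ∣ + r′ ℤ.- + r ∣ ≡ 0
    ∣D∣≡0 with ∣ q ℤ.- q′ ∣ in eq
    ... | zero  = trans ∣D∣≡ (cong (_* p) eq)
    ... | suc m = ⊥-elim (<⇒≱ ∣D∣<p
                    (subst (p ≤_) (sym (trans ∣D∣≡ (cong (_* p) eq))) (m≤m+n p (m * p))))

%ℕ-+-multiple : ∀ n q p .{{_ : NonZero p}} → (+ n ℤ.+ q ℤ.* + p) %ℕ p ≡ n % p
%ℕ-+-multiple n q p = %ℕ-unique _ p (q ℤ.+ + (n div p)) (n % p) (m%n<n n p) (begin
  + n ℤ.+ q ℤ.* + p
    ≡⟨ cong (ℤ._+ q ℤ.* + p) (a≡a%ℕn+[a/ℕn]*n (+ n) p) ⟩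
  + (n % p) ℤ.+ + (n div p) ℤ.* + p ℤ.+ q ℤ.* + p
    ≡⟨ regroup (+ (n % p)) (+ (n div p)) q (+ p) ⟩
  + (n % p) ℤ.+ (q ℤ.+ + (n div p)) ℤ.* + p
    ∎)
  where
    open ≡-Reasoning
    regroup : ∀ R D Q P → R ℤ.+ D ℤ.* P ℤ.+ Q ℤ.* P ≡ R ℤ.+ (Q ℤ.+ D) ℤ.* P
    regroup = ℤSolver.solve-∀

evenBelow : ℕ → ℕ → Bool
evenBelow zero    _             = false
evenBelow (suc n) zero          = true
evenBelow (suc n) (suc zero)    = false
evenBelow (suc n) (suc (suc k)) = evenBelow n k

evenBelow-odd : ∀ n t → evenBelow n (suc (double t)) ≡ false
evenBelow-odd zero    t       = refl
evenBelow-odd (suc n) zero    = refl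
evenBelow-odd (suc n) (suc t) = evenBelow-odd n t

evenBelow-beyond : ∀ n k → evenBelow n (double n + k) ≡ false
evenBelow-beyond zero    k = refl
evenBelow-beyond (suc n) k = evenBelow-beyond n k

evenBelow-true⇒ : ∀ n m → evenBelow n m ≡ true → ∃[ t ] (t < n × m ≡ double t)
evenBelow-true⇒ (suc n) zero          _  = 0 , s≤s z≤n , refl
evenBelow-true⇒ (suc n) (suc (suc m)) eq with evenBelow-true⇒ n m eq
... | t , t<n , refl = suc t , s≤s t<n , refl

count-evenBelow : ∀ n → count (evenBelow n) (double n) ≡ n
count-evenBelow zero    = refl
count-evenBelow (suc n) = cong suc (count-evenBelow n)

count-evenBelow-period : ∀ i → count (evenBelow i) (period i) ≡ i
count-evenBelow-period i = begin
  count (evenBelow i) (period i)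
    ≡⟨ cong (count (evenBelow i)) (+-comm 3 (double i)) ⟩
  count (evenBelow i) (double i + 3)
    ≡⟨ count-+ (evenBelow i) (double i) 3 ⟩
  count (evenBelow i) (double i) + count (λ k → evenBelow i (double i + k)) 3
    ≡⟨ cong₂ _+_ (count-evenBelow i) (count-cong 3 (λ k _ → evenBelow-beyond i k)) ⟩
  i + 0
    ≡⟨ +-identityʳ i ⟩
  i
    ∎
  where open ≡-Reasoning

double<period : ∀ {t} i → t ≤ suc i → double t < period i
double<period i t≤ = s≤s (double-mono-≤ t≤)

odd<period : ∀ {t} i → t ≤ i → suc (double t) < period i
odd<period i t≤ = s≤s (s≤s (≤-trans (double-mono-≤ t≤) (n≤1+n _)))

evenBelow-odd-residue : ∀ i t → t ≤ i → evenBelow i (suc (double t) % period i) ≡ false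
evenBelow-odd-residue i t t≤i =
  trans (cong (evenBelow i) (m<n⇒m%n≡m (odd<period i t≤i))) (evenBelow-odd i t)

evenBelow-gap : ∀ i t d → t < i → d ∈ 1 ∷ 3 ∷ 2 * i ∷ [] →
                evenBelow i ((double t + d) % period i) ≡ false
evenBelow-gap i t _ t<i (here refl) =
  subst (λ x → evenBelow i (x % period i) ≡ false) (+-comm 1 (double t))
        (evenBelow-odd-residue i t (<⇒≤ t<i))
evenBelow-gap i t _ t<i (there (here refl)) =
  subst (λ x → evenBelow i (x % period i) ≡ false) (+-comm 3 (double t))
        (evenBelow-odd-residue i (suc t) t<i)
evenBelow-gap i t _ t<i (there (there (here refl))) =
  subst (λ d → evenBelow i ((double t + d) % period i) ≡ false) (double≡2* i) (gap t t<i)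
  where
    gap : ∀ t → t < i → evenBelow i ((double t + double i) % period i) ≡ false
    gap zero _ =
      trans (cong (evenBelow i) (m<n⇒m%n≡m (double<period i (n≤1+n i))))
            (subst (λ x → evenBelow i x ≡ false) (+-identityʳ (double i)) (evenBelow-beyond i 0))
    gap (suc zero) _ =
      trans (cong (evenBelow i) (m<n⇒m%n≡m (double<period i ≤-refl)))
            (subst (λ x → evenBelow i x ≡ false) (+-comm (double i) 2) (evenBelow-beyond i 2))
    gap (suc (suc t)) t<i =
      trans (cong (evenBelow i) (trans (cong (_% period i) (wrap (double t) (double i)))
                                       ([m+n]%n≡m%n (suc (double t)) (period i))))
            (evenBelow-odd-residue i t (≤-trans (m≤n+m t 2) (<⇒≤ t<i)))
      where
        wrap : ∀ a b → suc (suc (suc (suc (a + b)))) ≡ suc a + suc (suc (suc b))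
        wrap = solve-∀

evenResidues : ℕ → Subsetℤ
evenResidues i x = evenBelow i (x %ℕ period i)

forward⇒independent : ∀ {S A} → (∀ x d → d ∈ S → A x ≡ true → A (x ℤ.+ + d) ≡ true → ⊥) →
                      Independent S A
forward⇒independent {S} {A} forward x y Ax Ay d∈S with x ℤ.- y in eq
... | + n      = forward y n d∈S Ay (subst (λ z → A z ≡ true) x≡ Ax)
  where
    restore : ∀ y x → y ℤ.+ (x ℤ.- y) ≡ x
    restore = ℤSolver.solve-∀
    x≡ : x ≡ y ℤ.+ + n
    x≡ = trans (sym (restore y x)) (cong (ℤ._+_ y) eq)
... | -[1+ n ] = forward x (suc n) d∈S Ax (subst (λ z → A z ≡ true) y≡ Ay)
  where
    restore : ∀ x y → x ℤ.+ ℤ.- (x ℤ.- y) ≡ y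
    restore = ℤSolver.solve-∀
    y≡ : y ≡ x ℤ.+ + suc n
    y≡ = trans (sym (restore x y)) (cong (λ w → x ℤ.+ ℤ.- w) eq)

evenResidues-independent : ∀ i → Independent (1 ∷ 3 ∷ 2 * i ∷ []) (evenResidues i)
evenResidues-independent i = forward⇒independent forward
  where
    p : ℕ
    p = period i
    forward : ∀ x d → d ∈ 1 ∷ 3 ∷ 2 * i ∷ [] →
              evenResidues i x ≡ true → evenResidues i (x ℤ.+ + d) ≡ true → ⊥
    forward x d d∈S Ax Axd with evenBelow-true⇒ i (x %ℕ p) Ax
    ... | t , t<i , r≡2t =
      not-¬ (trans (cong (evenBelow i) (sym residue)) Axd) (evenBelow-gap i t d t<i d∈S)
      where
        swap : ∀ a b c → a ℤ.+ b ℤ.+ c ≡ a ℤ.+ c ℤ.+ b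
        swap = ℤSolver.solve-∀
        shifted : x ℤ.+ + d ≡ + (x %ℕ p + d) ℤ.+ (x /ℕ p) ℤ.* + p
        shifted = begin
          x ℤ.+ + d
            ≡⟨ cong (ℤ._+ + d) (a≡a%ℕn+[a/ℕn]*n x p) ⟩
          + (x %ℕ p) ℤ.+ (x /ℕ p) ℤ.* + p ℤ.+ + d
            ≡⟨ swap (+ (x %ℕ p)) (x /ℕ p ℤ.* + p) (+ d) ⟩
          + (x %ℕ p) ℤ.+ + d ℤ.+ (x /ℕ p) ℤ.* + p
            ≡⟨ cong (ℤ._+ (x /ℕ p) ℤ.* + p) (sym (ℤP.pos-+ (x %ℕ p) d)) ⟩
          + (x %ℕ p + d) ℤ.+ (x /ℕ p) ℤ.* + p
            ∎
          where open ≡-Reasoning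
        residue : (x ℤ.+ + d) %ℕ p ≡ (double t + d) % p
        residue = trans (cong (_%ℕ p) shifted)
          (trans (%ℕ-+-multiple (x %ℕ p + d) (x /ℕ p) p) (cong (λ r → (r + d) % p) r≡2t))

-- [-M·p, M·p] consists of 2M full periods followed by the point M·p, whose residue is 0.
countSym-evenResidues : ∀ i M →
  countSym (evenResidues (suc i)) (M * period (suc i)) ≡ suc (double M * suc i)
countSym-evenResidues i M = begin
  countSym A (M * p)
    ≡⟨ countSym≡count A (M * p) ⟩
  count (seqFrom A (ℤ.- + (M * p))) (suc (double (M * p)))
    ≡⟨ count-cong (suc (double (M * p))) (λ k _ → cong (evenBelow (suc i)) (residue k)) ⟩
  count g (suc (double (M * p)))
    ≡⟨ count-last-true g (double (M * p)) last-true ⟩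
  suc (count g (double (M * p)))
    ≡⟨ cong (suc ∘ count g) (double-* M p) ⟩
  suc (count g (double M * p))
    ≡⟨ cong suc (count-periodic g p (double M) g-periodic) ⟩
  suc (double M * count g p)
    ≡⟨ cong (λ c → suc (double M * c)) (trans (count-cong p g-below) (count-evenBelow-period (suc i))) ⟩
  suc (double M * suc i)
    ∎
  where
    open ≡-Reasoning
    A : Subsetℤ
    A = evenResidues (suc i)
    p : ℕ
    p = period (suc i)
    g : ℕ → Bool
    g k = evenBelow (suc i) (k % p)
    reorder : ∀ m p k → ℤ.- (m ℤ.* p) ℤ.+ k ≡ k ℤ.+ ℤ.- m ℤ.* p
    reorder = ℤSolver.solve-∀
    residue : ∀ k → (ℤ.- + (M * p) ℤ.+ + k) %ℕ p ≡ k % p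
    residue k = trans
      (cong (_%ℕ p) (trans (cong (λ z → ℤ.- z ℤ.+ + k) (ℤP.pos-* M p)) (reorder (+ M) (+ p) (+ k))))
      (%ℕ-+-multiple k (ℤ.- + M) p)
    last-true : g (double (M * p)) ≡ true
    last-true = cong (evenBelow (suc i)) (trans (cong (_% p) (double-* M p)) (m*n%n≡0 (double M) p))
    g-periodic : ∀ k → g (p + k) ≡ g k
    g-periodic k = cong (evenBelow (suc i)) (trans (cong (_% p) (+-comm p k)) ([m+n]%n≡m%n k p))
    g-below : ∀ k → k < p → g k ≡ evenBelow (suc i) k
    g-below k k<p = cong (evenBelow (suc i)) (m<n⇒m%n≡m k<p)

toℚᵘ-/ : ∀ a m → ℚ.toℚᵘ ((+ a) / suc m) ℚᵘ.≃ ℚᵘ.mkℚᵘ (+ a) m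
toℚᵘ-/ a m = ℚP.toℚᵘ-fromℚᵘ (ℚᵘ.mkℚᵘ (+ a) m)

/≤/ : ∀ a m b n → a * suc n ≤ b * suc m → (+ a) / suc m ℚ.≤ (+ b) / suc n
/≤/ a m b n h = ℚP.toℚᵘ-cancel-≤
  (ℚᵘP.≤-respˡ-≃ (ℚᵘP.≃-sym (toℚᵘ-/ a m)) (ℚᵘP.≤-respʳ-≃ (ℚᵘP.≃-sym (toℚᵘ-/ b n))
    (ℚᵘ.*≤* (subst₂ ℤ._≤_ (ℤP.pos-* a (suc n)) (ℤP.pos-* b (suc m)) (ℤ.+≤+ h)))))

/≤/+mkℚ : ∀ c L i q n d .(cop : Coprime (suc n) (suc d)) →
          c * (suc q * suc d) ≤ (i * suc d + suc n * suc q) * suc L →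
          (+ c) / suc L ℚ.≤ (+ i) / suc q ℚ.+ mkℚ (+ suc n) d cop
/≤/+mkℚ c L i q n d cop h = ℚP.toℚᵘ-cancel-≤
  (ℚᵘP.≤-respˡ-≃ (ℚᵘP.≃-sym (toℚᵘ-/ c L)) (ℚᵘP.≤-respʳ-≃ (ℚᵘP.≃-sym sum≃)
    (ℚᵘ.*≤* (subst₂ ℤ._≤_ lhs rhs (ℤ.+≤+ h)))))
  where
    sum≃ : ℚ.toℚᵘ ((+ i) / suc q ℚ.+ mkℚ (+ suc n) d cop) ℚᵘ.≃
           ℚᵘ.mkℚᵘ (+ i) q ℚᵘ.+ ℚᵘ.mkℚᵘ (+ suc n) d
    sum≃ = ℚᵘP.≃-trans (ℚP.toℚᵘ-homo-+ ((+ i) / suc q) (mkℚ (+ suc n) d cop))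
                       (ℚᵘP.+-congˡ _ (toℚᵘ-/ i q))
    lhs : + (c * (suc q * suc d)) ≡ + c ℤ.* + (suc q * suc d)
    lhs = ℤP.pos-* c (suc q * suc d)
    rhs : + ((i * suc d + suc n * suc q) * suc L) ≡
          (+ i ℤ.* + suc d ℤ.+ + suc n ℤ.* + suc q) ℤ.* + suc L
    rhs = trans (ℤP.pos-* (i * suc d + suc n * suc q) (suc L))
                (cong (ℤ._* + suc L) (trans (ℤP.pos-+ (i * suc d) (suc n * suc q))
                      (cong₂ ℤ._+_ (ℤP.pos-* i (suc d)) (ℤP.pos-* (suc n) (suc q)))))

-- With P = q + 1, the hypothesis gives ratio ≤ i / P + P / (2N + 1), and the error term is at most
-- ε = (n + 1) / D as soon as 2N + 1 ≥ P·D.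
densityAtMost-linear : ∀ A i q → (∀ N → countSym A N * suc q ≤ i * suc (2 * N) + suc q * suc q) →
                       DensityAtMost A ((+ i) / suc q)
densityAtMost-linear A i q bound (mkℚ (+ suc n) d cop) _ = P * D , λ N PD≤N →
  /≤/+mkℚ (countSym A N) (2 * N) i q n d cop
    (absorb {countSym A N} (bound N) (≤-trans PD≤N (≤-trans (m≤m+n N (N + 0)) (n≤1+n _))))
  where
    P D : ℕ
    P = suc q
    D = suc d
    expand : ∀ i L P D → (i * L + P * P) * D ≡ i * D * L + P * (P * D)
    expand = solve-∀
    collect : ∀ i D L P n → i * D * L + (P * L + n * P * L) ≡ (i * D + suc n * P) * L
    collect = solve-∀
    absorb : ∀ {c L} → c * P ≤ i * L + P * P → P * D ≤ L → c * (P * D) ≤ (i * D + suc n * P) * L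
    absorb {c} {L} cP≤ PD≤L = begin
      c * (P * D)                      ≡⟨ sym (*-assoc c P D) ⟩
      c * P * D                        ≤⟨ *-monoˡ-≤ D cP≤ ⟩
      (i * L + P * P) * D              ≡⟨ expand i L P D ⟩
      i * D * L + P * (P * D)          ≤⟨ +-monoʳ-≤ (i * D * L) (*-monoʳ-≤ P PD≤L) ⟩
      i * D * L + P * L                ≤⟨ +-monoʳ-≤ (i * D * L) (m≤m+n (P * L) (n * P * L)) ⟩
      i * D * L + (P * L + n * P * L)  ≡⟨ collect i D L P n ⟩
      (i * D + suc n * P) * L          ∎
      where open ≤-Reasoning
densityAtMost-linear A i q bound (mkℚ (+ zero) d _) (ℚ.*<* (ℤ.+<+ ()))
densityAtMost-linear A i q bound (mkℚ -[1+ n ] d _) (ℚ.*<* ())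

p-q<p : ∀ p q → 0ℚ ℚ.< q → p ℚ.- q ℚ.< p
p-q<p p q 0<q = subst (p ℚ.- q ℚ.<_) (ℚP.+-identityʳ p) (ℚP.+-monoʳ-< p (ℚP.neg-antimono-< 0<q))

densityAtLeast-frequently : ∀ A r → (∀ N₀ → ∃[ N ] (N₀ ≤ N × r ℚ.≤ ratio A N)) →
                            ∀ s → s ℚ.≤ r → DensityAtLeast A s
densityAtLeast-frequently A r often s s≤r ε 0<ε N₀ with often N₀
... | N , N₀≤N , r≤ = N , N₀≤N , ℚP.<-≤-trans (p-q<p s ε 0<ε) (ℚP.≤-trans s≤r r≤)

evenResidues-frequently : ∀ i N₀ →
  ∃[ N ] (N₀ ≤ N × (+ suc i) / suc (2 * suc i + 2) ℚ.≤ ratio (evenResidues (suc i)) N)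
evenResidues-frequently i N₀ = N₀ * period (suc i) , m≤m*n N₀ (period (suc i)) ,
  /≤/ (suc i) (2 * suc i + 2) (countSym (evenResidues (suc i)) (N₀ * period (suc i)))
      (2 * (N₀ * period (suc i))) (begin
    suc i * suc (2 * (N₀ * period (suc i)))
      ≡⟨ cong (λ p → suc i * suc (2 * (N₀ * p))) (period≡ (suc i)) ⟩
    suc i * suc (2 * (N₀ * p))
      ≡⟨ spread (suc i) N₀ p ⟩
    suc i + 2 * N₀ * suc i * p
      ≤⟨ +-monoˡ-≤ (2 * N₀ * suc i * p) i≤p ⟩
    suc (2 * N₀ * suc i) * p
      ≡⟨ cong (λ m → suc (m * suc i) * p) (sym (double≡2* N₀)) ⟩
    suc (double N₀ * suc i) * p
      ≡⟨ cong (_* p) (sym (countSym-evenResidues i N₀)) ⟩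
    countSym (evenResidues (suc i)) (N₀ * period (suc i)) * p
      ∎)
  where
    open ≤-Reasoning
    p : ℕ
    p = suc (2 * suc i + 2)
    spread : ∀ I M p → I * suc (2 * (M * p)) ≡ I + 2 * M * I * p
    spread = solve-∀
    i≤p : suc i ≤ p
    i≤p = ≤-trans (m≤m+n (suc i) (suc i + 0)) (≤-trans (m≤m+n _ 2) (n≤1+n _))

theorem27 : ∀ (i : ℕ) → 2 ≤ i →
    IndependenceRatioIs (1 ∷ 3 ∷ 2 * i ∷ []) ((+ i) / suc (2 * i + 2))
theorem27 (suc (suc j)) _ =
  (λ A indep → densityAtMost-linear A i (2 * i + 2) (countSym-independent-≤ j A indep)) ,
  (λ ε 0<ε → evenResidues i , evenResidues-independent i ,
     densityAtLeast-frequently (evenResidues i) r (evenResidues-frequently (suc j))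
       (r ℚ.- ε) (ℚP.<⇒≤ (p-q<p r ε 0<ε)))
  where
    i : ℕ
    i = suc (suc j)
    r : ℚ.ℚ
    r = (+ i) / suc (2 * i + 2)
theorem27 (suc zero) (s≤s ())
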